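{- Let $n=2^k+r$ with $0<r<2^k$, and let $\rho_1$ be the position of the least significant nonzero bit of $n$ (so $2^{\rho_1}$ is the largest power of $2$ dividing $n$). Then $$\delta(n)=\tfrac12\bigl(\delta(n-1)+\delta(n+1)\bigr)+1-\rho_1,$$ where $\delta(m)$ denotes the number of $D$-nodes in the divide-and-conquer tree with $m$ leaves.
   Context: A full binary tree is a rooted tree in which every node has $0$ or $2$ children. An internal node is a $D$-node if its two children have different numbers of descendant leaves. A divide-and-conquer tree is a full binary tree in which, at every internal node, the numbers of leaves of the left and right subtrees differ by at most $1$; it is unique up to isomorphism for each number of leaves. -}

module Defs where

open import Data.Nat using (ℕ; zero; suc; _+_; _≤_; _≟_)
open import Relation.Nullary using (yes; no)
open import Data.Empty using (⊥)
open import Data.Unit using (⊤)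
open import Data.Product using (_×_)
open import Relation.Binary.PropositionalEquality using (_≡_; _≢_)

data Tree : Set where
  leaf : Tree
  node : Tree → Tree → Tree

leaves : Tree → ℕ
leaves leaf       = 1
leaves (node l r) = leaves l + leaves r

isD : Tree → Tree → ℕ
isD l r with leaves l ≟ leaves r
... | yes _ = 0
... | no  _ = 1

dnodes : Tree → ℕ
dnodes leaf       = 0
dnodes (node l r) = isD l r + dnodes l + dnodes r

Close : ℕ → ℕ → Set
Close a b = (a ≤ suc b) × (b ≤ suc a)

IsDC : Tree → Set
IsDC leaf       = ⊤
IsDC (node l r) = Close (leaves l) (leaves r) × IsDC l × IsDC r

{-# OPTIONS --safe #-}
-- It does not
-- depend on the tree: the subtrees of the root have ⌊m/2⌋ and ⌈m/2⌉ leaves, so by induction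
-- δ(2m) = 2δ(m) and δ(2m+1) = δ(m) + δ(m+1) + 1. Write n = 2^ρ·o with o ≥ 3 odd and let
-- Δ(n) = δ(n-1) - 2δ(n) + δ(n+1). For ρ = 0 the odd recurrence at n and the even one at n ± 1
-- give Δ(n) = -2; the even recurrence at 2a and the odd ones at 2a ± 1 give Δ(2a) = Δ(a) + 2.
-- Hence Δ(n) = 2ρ - 2. The hypothesis 2^k < n < 2^(k+1) only serves to exclude o = 1.
module Submission where

open import Defs
open import Data.Nat using (ℕ; zero; suc; _+_; _*_; _^_; _<_; _≤_; _∸_; z≤n; s≤s; _≟_; _≤?_)
open import Data.Nat.Properties
open import Data.Nat.Divisibility using (_∣_; divides)
import Data.Nat.Tactic.RingSolver as ℕ-Solver
open import Data.Integer using (+_; _-_) renaming (_+_ to _+ℤ_; _*_ to _*ℤ_)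
open import Data.Integer.Properties using (pos-+)
import Data.Integer.Tactic.RingSolver as ℤ-Solver
open import Data.Product using (_×_; _,_)
open import Data.Sum using (_⊎_; inj₁; inj₂)
open import Data.Empty using (⊥-elim)
open import Relation.Binary using (tri<; tri≈; tri>)
open import Relation.Nullary using (¬_; yes; no; contradiction)
open import Relation.Binary.PropositionalEquality
open import Function using (_∘_)

private
  variable
    a b : ℕ
    l r T U : Tree

data Halving : ℕ → Set where
  even : ∀ m → Halving (m + m)
  odd  : ∀ m → Halving (suc (m + m))

halving : ∀ n → Halving n
halving zero = even zero
halving (suc n) with halving n
... | even m = odd m
... | odd m  = subst Halving (cong suc (+-suc m m)) (even (suc m))

m+m≡2*m : ∀ m → m + m ≡ 2 * m
m+m≡2*m m = cong (_+_ m) (sym (+-identityʳ m))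

m+m≡n+n⇒m≡n : ∀ m n → m + m ≡ n + n → m ≡ n
m+m≡n+n⇒m≡n m n e = *-cancelˡ-≡ m n 2 (trans (sym (m+m≡2*m m)) (trans e (m+m≡2*m n)))

m+m≢1+n+n : ∀ m n → m + m ≢ suc (n + n)
m+m≢1+n+n m n e = even≢odd m n (trans (sym (m+m≡2*m m)) (trans e (cong suc (m+m≡2*m n))))

close-cases : Close a b → a ≡ b ⊎ a ≡ suc b ⊎ b ≡ suc a
close-cases {a} {b} (a≤1+b , b≤1+a) with <-cmp a b
... | tri< a<b _ _ = inj₂ (inj₂ (≤-antisym b≤1+a a<b))
... | tri≈ _ a≡b _ = inj₁ a≡b
... | tri> _ _ b<a = inj₂ (inj₁ (≤-antisym a≤1+b b<a))

close-even : ∀ m → Close a b → a + b ≡ m + m → a ≡ m × b ≡ m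
close-even {a} {b} m c e with close-cases c
... | inj₁ refl        = let a≡m = m+m≡n+n⇒m≡n a m e in a≡m , a≡m
... | inj₂ (inj₁ refl) = ⊥-elim (m+m≢1+n+n m b (sym e))
... | inj₂ (inj₂ refl) = ⊥-elim (m+m≢1+n+n m a (sym (trans (sym (+-suc a a)) e)))

close-odd : ∀ m → Close a b → a + b ≡ suc (m + m) →
  (a ≡ m × b ≡ suc m) ⊎ (a ≡ suc m × b ≡ m)
close-odd {a} {b} m c e with close-cases c
... | inj₁ refl        = ⊥-elim (m+m≢1+n+n a m e)
... | inj₂ (inj₁ refl) = let b≡m = m+m≡n+n⇒m≡n b m (suc-injective e) in inj₂ (cong suc b≡m , b≡m)
... | inj₂ (inj₂ refl) = let a≡m = m+m≡n+n⇒m≡n a m (suc-injective (trans (sym (+-suc a a)) e))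
                         in inj₁ (a≡m , cong suc a≡m)

close-split-unique : ∀ {c d} → Close a b → Close c d → a + b ≡ c + d →
  (a ≡ c × b ≡ d) ⊎ (a ≡ d × b ≡ c)
close-split-unique {a} {b} {c} {d} cab ccd e = by-halving (halving (c + d)) e refl
  where
  by-halving : ∀ {s} → Halving s → a + b ≡ s → c + d ≡ s → (a ≡ c × b ≡ d) ⊎ (a ≡ d × b ≡ c)
  by-halving (even m) e₁ e₂ with close-even m cab e₁ | close-even m ccd e₂
  ... | a≡ , b≡ | c≡ , d≡ = inj₁ (trans a≡ (sym c≡) , trans b≡ (sym d≡))
  by-halving (odd m) e₁ e₂ with close-odd m cab e₁ | close-odd m ccd e₂
  ... | inj₁ (a≡ , b≡) | inj₁ (c≡ , d≡) = inj₁ (trans a≡ (sym c≡) , trans b≡ (sym d≡))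
  ... | inj₁ (a≡ , b≡) | inj₂ (c≡ , d≡) = inj₂ (trans a≡ (sym d≡) , trans b≡ (sym c≡))
  ... | inj₂ (a≡ , b≡) | inj₁ (c≡ , d≡) = inj₂ (trans a≡ (sym d≡) , trans b≡ (sym c≡))
  ... | inj₂ (a≡ , b≡) | inj₂ (c≡ , d≡) = inj₁ (trans a≡ (sym c≡) , trans b≡ (sym d≡))

leaves-positive : ∀ T → 0 < leaves T
leaves-positive leaf       = s≤s z≤n
leaves-positive (node l r) = ≤-trans (leaves-positive l) (m≤m+n (leaves l) (leaves r))

leaves-node>1 : ∀ l r → 1 < leaves (node l r)
leaves-node>1 l r = +-mono-≤ (leaves-positive l) (leaves-positive r)

isD-≡ : leaves l ≡ leaves r → isD l r ≡ 0
isD-≡ {l} {r} e with leaves l ≟ leaves r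
... | yes _ = refl
... | no ne = contradiction e ne

isD-≢ : leaves l ≢ leaves r → isD l r ≡ 1
isD-≢ {l} {r} ne with leaves l ≟ leaves r
... | yes e = contradiction e ne
... | no _  = refl

isD-cong : ∀ {l′ r′} → leaves l ≡ leaves l′ → leaves r ≡ leaves r′ → isD l r ≡ isD l′ r′
isD-cong {l} {r} el er with leaves l ≟ leaves r
... | yes e = sym (isD-≡ (trans (sym el) (trans e er)))
... | no ne = sym (isD-≢ λ e → ne (trans el (trans e (sym er))))

isD-comm : ∀ l r → isD l r ≡ isD r l
isD-comm l r with leaves l ≟ leaves r
... | yes e = sym (isD-≡ (sym e))
... | no ne = sym (isD-≢ (ne ∘ sym))

dnodes-comm : ∀ l r → dnodes (node l r) ≡ dnodes (node r l)
dnodes-comm l r = begin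
  isD l r + dnodes l + dnodes r   ≡⟨ +-assoc (isD l r) (dnodes l) (dnodes r) ⟩
  isD l r + (dnodes l + dnodes r) ≡⟨ cong₂ _+_ (isD-comm l r) (+-comm (dnodes l) (dnodes r)) ⟩
  isD r l + (dnodes r + dnodes l) ≡⟨ +-assoc (isD r l) (dnodes r) (dnodes l) ⟨
  isD r l + dnodes r + dnodes l   ∎
  where open ≡-Reasoning

dnodes-unique : IsDC T → IsDC U → leaves T ≡ leaves U → dnodes T ≡ dnodes U
dnodes-unique {leaf}     {leaf}       _ _ _ = refl
dnodes-unique {leaf}     {node l r}   _ _ e = contradiction e (<⇒≢ (leaves-node>1 l r))
dnodes-unique {node l r} {leaf}       _ _ e = contradiction (sym e) (<⇒≢ (leaves-node>1 l r))
dnodes-unique {node l r} {node l′ r′} (c , dcl , dcr) (c′ , dcl′ , dcr′) e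
  with close-split-unique c c′ e
... | inj₁ (el , er) =
  cong₂ _+_ (cong₂ _+_ (isD-cong el er) (dnodes-unique dcl dcl′ el)) (dnodes-unique dcr dcr′ er)
... | inj₂ (el , er) = trans
  (cong₂ _+_ (cong₂ _+_ (isD-cong el er) (dnodes-unique dcl dcr′ el)) (dnodes-unique dcr dcl′ er))
  (dnodes-comm r′ l′)

record Fork (T : Tree) (a b c : ℕ) : Set where
  constructor fork
  field
    {left right} : Tree
    left-isDC    : IsDC left
    right-isDC   : IsDC right
    leaves-left  : leaves left ≡ a
    leaves-right : leaves right ≡ b
    dnodes-fork  : dnodes T ≡ c + dnodes left + dnodes right

fork-even : ∀ m → IsDC T → leaves T ≡ suc m + suc m → Fork T (suc m) (suc m) 0
fork-even {leaf}     m _ e = contradiction (sym (suc-injective e)) (m+1+n≢0 m)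
fork-even {node l r} m (c , dcl , dcr) e with close-even (suc m) c e
... | el , er = fork dcl dcr el er (cong (λ d → d + dnodes l + dnodes r) (isD-≡ (trans el (sym er))))

fork-odd : ∀ m → IsDC T → leaves T ≡ suc (suc m + suc m) → Fork T (suc m) (suc (suc m)) 1
fork-odd {node l r} m (c , dcl , dcr) e with close-odd (suc m) c e
... | inj₁ (el , er) = fork dcl dcr el er
  (cong (λ d → d + dnodes l + dnodes r) (isD-≢ λ e′ → <⇒≢ (n<1+n _) (trans (sym el) (trans e′ er))))
... | inj₂ (el , er) = fork dcr dcl er el (trans (dnodes-comm l r)
  (cong (λ d → d + dnodes r + dnodes l) (isD-≢ λ e′ → <⇒≢ (n<1+n _) (trans (sym er) (trans e′ el)))))

o*2^[1+ρ]≡a+a : ∀ o ρ → o * 2 ^ suc ρ ≡ o * 2 ^ ρ + o * 2 ^ ρ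
o*2^[1+ρ]≡a+a o ρ = double o (2 ^ ρ)
  where
  double : ∀ o m → o * (2 * m) ≡ o * m + o * m
  double = ℕ-Solver.solve-∀

2≤[3+2h]*2^ρ : ∀ h ρ → 2 ≤ suc (suc h + suc h) * 2 ^ ρ
2≤[3+2h]*2^ρ h ρ = ≤-trans (s≤s (s≤s z≤n)) (m≤m*n (suc (suc h + suc h)) (2 ^ ρ) {{m^n≢0 2 ρ}})

second-difference-base : ∀ x y → (1 + x + y) + (1 + x + y) + (0 + 0) ≡ (0 + x + x) + (0 + y + y) + 2
second-difference-base = ℕ-Solver.solve-∀

second-difference-step : ∀ x y z ρ → x + x + (ρ + ρ) ≡ y + z + 2 →
  (0 + x + x) + (0 + x + x) + (suc ρ + suc ρ) ≡ (1 + y + x) + (1 + x + z) + 2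
second-difference-step x y z ρ ih = begin
  (0 + x + x) + (0 + x + x) + (suc ρ + suc ρ) ≡⟨ regroupˡ x ρ ⟩
  (x + x + (ρ + ρ)) + (x + x) + 2             ≡⟨ cong (λ w → w + (x + x) + 2) ih ⟩
  (y + z + 2) + (x + x) + 2                   ≡⟨ regroupʳ x y z ⟩
  (1 + y + x) + (1 + x + z) + 2               ∎
  where
  open ≡-Reasoning
  regroupˡ : ∀ x ρ → (0 + x + x) + (0 + x + x) + (suc ρ + suc ρ) ≡ (x + x + (ρ + ρ)) + (x + x) + 2
  regroupˡ = ℕ-Solver.solve-∀
  regroupʳ : ∀ x y z → (y + z + 2) + (x + x) + 2 ≡ (1 + y + x) + (1 + x + z) + 2
  regroupʳ = ℕ-Solver.solve-∀

dnodes-second-difference : ∀ ρ h {T T₋ T₊} → let n = suc (suc h + suc h) * 2 ^ ρ in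
  IsDC T  → leaves T  ≡ n →
  IsDC T₋ → leaves T₋ ≡ n ∸ 1 →
  IsDC T₊ → leaves T₊ ≡ suc n →
  dnodes T + dnodes T + (ρ + ρ) ≡ dnodes T₋ + dnodes T₊ + 2
dnodes-second-difference zero h dcT lT dcT₋ lT₋ dcT₊ lT₊
  with o*1≡o ← *-identityʳ (suc (suc h + suc h))
  with fork-odd h dcT (trans lT o*1≡o)
     | fork-even h dcT₋ (trans lT₋ (cong (_∸ 1) o*1≡o))
     | fork-even (suc h) dcT₊ (trans lT₊ (cong suc (trans o*1≡o (sym (+-suc (suc h) (suc h))))))
... | fork {l} {r} dl dr ll lr dT | fork dp dq lp lq dT₋ | fork ds dt ls lt dT₊
  rewrite dT | dT₋ | dT₊
        | dnodes-unique dp dl (trans lp (sym ll)) | dnodes-unique dq dl (trans lq (sym ll))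
        | dnodes-unique ds dr (trans ls (sym lr)) | dnodes-unique dt dr (trans lt (sym lr))
  = second-difference-base (dnodes l) (dnodes r)
dnodes-second-difference (suc ρ) h dcT lT dcT₋ lT₋ dcT₊ lT₊
  with m , a≡2+m ← m≤n⇒∃[o]m+o≡n (2≤[3+2h]*2^ρ h ρ)
  with n≡2a ← trans (o*2^[1+ρ]≡a+a (suc (suc h + suc h)) ρ) (cong₂ _+_ (sym a≡2+m) (sym a≡2+m))
  with fork-even (suc m) dcT (trans lT n≡2a)
     | fork-odd m dcT₋ (trans lT₋ (trans (cong (_∸ 1) n≡2a) (+-suc (suc m) (suc m))))
     | fork-odd (suc m) dcT₊ (trans lT₊ (cong suc n≡2a))
... | fork {l} dl dr ll lr dT | fork {p} dp dq lp lq dT₋ | fork {right = t} ds dt ls lt dT₊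
  rewrite dT | dT₋ | dT₊
        | dnodes-unique dr dl (trans lr (sym ll)) | dnodes-unique dq dl (trans lq (sym ll))
        | dnodes-unique ds dl (trans ls (sym ll))
  = second-difference-step (dnodes l) (dnodes p) (dnodes t) ρ
      (dnodes-second-difference ρ h dl (trans ll a≡2+m)
                                    dp (trans lp (cong (_∸ 1) a≡2+m))
                                    dt (trans lt (cong suc a≡2+m)))

2^k+r≢2^ρ : ∀ k r ρ → 0 < r → r < 2 ^ k → 2 ^ k + r ≢ 2 ^ ρ
2^k+r≢2^ρ k r ρ 0<r r<2^k e with ρ ≤? k
... | yes ρ≤k = <⇒≱ (subst (2 ^ k <_) e (m<m+n (2 ^ k) 0<r)) (^-monoʳ-≤ 2 ρ≤k)
... | no  ρ≰k = <⇒≱ (subst (_< 2 ^ suc k) e 2^k+r<2^[1+k]) (^-monoʳ-≤ 2 (≰⇒> ρ≰k))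
  where
  2^k+r<2^[1+k] : 2 ^ k + r < 2 ^ suc k
  2^k+r<2^[1+k] = subst (2 ^ k + r <_) (m+m≡2*m (2 ^ k)) (+-monoʳ-< (2 ^ k) r<2^k)

[j+j]*2^ρ≡j*2^[1+ρ] : ∀ j ρ → (j + j) * 2 ^ ρ ≡ j * 2 ^ suc ρ
[j+j]*2^ρ≡j*2^[1+ρ] j ρ = regroup j (2 ^ ρ)
  where
  regroup : ∀ j m → (j + j) * m ≡ j * (2 * m)
  regroup = ℕ-Solver.solve-∀

second-difference-ℕ⇒ℤ : ∀ x a b ρ → x + x + (ρ + ρ) ≡ a + b + 2 →
  + 2 *ℤ + x ≡ (+ a +ℤ + b) +ℤ + 2 *ℤ (+ 1 - + ρ)
second-difference-ℕ⇒ℤ x a b ρ e = begin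
  + 2 *ℤ + x                                      ≡⟨ isolate (+ x) (+ ρ) ⟩
  (+ x +ℤ + x +ℤ (+ ρ +ℤ + ρ)) - (+ ρ +ℤ + ρ)     ≡⟨ cong (_- (+ ρ +ℤ + ρ)) e-ℤ ⟩
  (+ a +ℤ + b +ℤ + 2) - (+ ρ +ℤ + ρ)              ≡⟨ collect (+ a) (+ b) (+ ρ) ⟩
  (+ a +ℤ + b) +ℤ + 2 *ℤ (+ 1 - + ρ)              ∎
  where
  open ≡-Reasoning
  isolate : ∀ x ρ → + 2 *ℤ x ≡ (x +ℤ x +ℤ (ρ +ℤ ρ)) - (ρ +ℤ ρ)
  isolate = ℤ-Solver.solve-∀
  collect : ∀ a b ρ → (a +ℤ b +ℤ + 2) - (ρ +ℤ ρ) ≡ (a +ℤ b) +ℤ + 2 *ℤ (+ 1 - ρ)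
  collect = ℤ-Solver.solve-∀
  e-ℤ : + x +ℤ + x +ℤ (+ ρ +ℤ + ρ) ≡ + a +ℤ + b +ℤ + 2
  e-ℤ = begin
    + x +ℤ + x +ℤ (+ ρ +ℤ + ρ) ≡⟨ cong₂ _+ℤ_ (pos-+ x x) (pos-+ ρ ρ) ⟨
    + (x + x) +ℤ + (ρ + ρ)     ≡⟨ pos-+ (x + x) (ρ + ρ) ⟨
    + (x + x + (ρ + ρ))        ≡⟨ cong +_ e ⟩
    + (a + b + 2)              ≡⟨ pos-+ (a + b) 2 ⟩
    + (a + b) +ℤ + 2           ≡⟨ cong (_+ℤ + 2) (pos-+ a b) ⟩
    + a +ℤ + b +ℤ + 2          ∎

corollary56 : (n k r ρ₁ : ℕ) → n ≡ 2 ^ k + r → 0 < r → r < 2 ^ k →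
    2 ^ ρ₁ ∣ n → ¬ (2 ^ suc ρ₁ ∣ n) →
    (T T₋ T₊ : Tree) →
    IsDC T → leaves T ≡ n →
    IsDC T₋ → leaves T₋ ≡ n ∸ 1 →
    IsDC T₊ → leaves T₊ ≡ suc n →
    + 2 *ℤ + dnodes T ≡ (+ dnodes T₋ +ℤ + dnodes T₊) +ℤ + 2 *ℤ (+ 1 - + ρ₁)
corollary56 n k r ρ n≡2^k+r 0<r r<2^k (divides c refl) 2^[1+ρ]∤n T T₋ T₊ dcT lT dcT₋ lT₋ dcT₊ lT₊
  with halving c
... | even j       = contradiction (divides j ([j+j]*2^ρ≡j*2^[1+ρ] j ρ)) 2^[1+ρ]∤n
... | odd zero     = contradiction (trans (sym n≡2^k+r) (*-identityˡ (2 ^ ρ))) (2^k+r≢2^ρ k r ρ 0<r r<2^k)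
... | odd (suc h)  = second-difference-ℕ⇒ℤ (dnodes T) (dnodes T₋) (dnodes T₊) ρ
  (dnodes-second-difference ρ h dcT lT dcT₋ lT₋ dcT₊ lT₊)
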